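{- For every algebraic signature $\Sigma$, the category $\mathbf{EqTG}_\Sigma$ has equalizers, binary products and pullbacks, and they are created by the inclusion functor $J_\Sigma\colon\mathbf{EqTG}_\Sigma\to\mathbf{EqHyp}_\Sigma$.
   Context: For a set $X$, $X^\star$ is the set of finite words over $X$, $f^\star$ acts letterwise, $\{*\}^\star\cong\mathbb N$ via length. A hypergraph is $(E,V,s,t)$ with $s,t\colon E\to V^\star$; morphisms $(h,k)$ with $k^\star\circ s=s'\circ h$, $k^\star\circ t=t'\circ h$ (category $\mathbf{Hyp}$). A hypergraph with equivalence is $(E,V,Q,s,t,q)$ with $(E,V,s,t)$ a hypergraph and $q\colon V\to Q$ surjective; morphisms are triples $(h_E,h_V,h_Q)$ with $(h_E,h_V)$ a hypergraph morphism and $h_Q\circ q=q'\circ h_V$ (category $\mathbf{EqHyp}$); $T\colon\mathbf{EqHyp}\to\mathbf{Hyp}$ forgets $Q,q$. Signature $\Sigma=(O_\Sigma,\mathsf{ar}_\Sigma\colon O_\Sigma\to\mathbb N)$; $\mathcal G^\Sigma=(O_\Sigma,\{*\},\mathsf{ar}_\Sigma,\gamma_1)$ with $\gamma_1$ sending every operation to the word of length 1. $\mathbf{EqHyp}_\Sigma$: objects $(\mathcal H,l)$ with $\mathcal H\in\mathbf{EqHyp}$, $l\colon T(\mathcal H)\to\mathcal G^\Sigma$ in $\mathbf{Hyp}$; morphisms are $\mathbf{EqHyp}$-morphisms $h$ with $l=l'\circ T(h)$. $\mathbf{EqTG}_\Sigma$ is the full subcategory of $\mathbf{EqHyp}_\Sigma$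 on those $(\mathcal H,l)$ for which the target function $t_{\mathcal H}$ is injective (i.e. $l\colon T(\mathcal H)\to\mathcal G^\Sigma$ is a term graph). -}

module Defs where

open import Level using (0ℓ)
open import Data.Nat using (ℕ)
open import Data.Unit using (⊤; tt)
open import Data.List using (List; []; _∷_; map; replicate)
open import Data.List.Properties using (map-∘)
open import Data.Product using (Σ; Σ-syntax; ∃; _×_; _,_; proj₁; proj₂)
open import Function using (_∘′_)
open import Function.Definitions using (Injective)
open import Relation.Binary.Bundles using (Setoid)
open import Relation.Binary.PropositionalEquality using (_≡_; refl; sym; trans; cong)

-- A bare category-like structure (objects, hom-sets, equality of
-- morphisms, composition): only what is needed to state limit notions.

record Cat : Set₂ where
  infix  4 _≈_
  infixr 9 _∘_
  field
    Ob  : Set₁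
    Hom : Ob → Ob → Set
    _≈_ : ∀ {A B} → Hom A B → Hom A B → Set
    _∘_ : ∀ {A B C} → Hom B C → Hom A B → Hom A C

module _ (C : Cat) where
  open Cat C

  IsEqualizer : ∀ {A B E} (f g : Hom A B) (e : Hom E A) → Set₁
  IsEqualizer {A} {B} {E} f g e =
    (f ∘ e ≈ g ∘ e) ×
    (∀ (X : Ob) (x : Hom X A) → f ∘ x ≈ g ∘ x →
       Σ (Hom X E) λ u → (e ∘ u ≈ x) × (∀ (u′ : Hom X E) → e ∘ u′ ≈ x → u′ ≈ u))

  IsProduct : ∀ {A B P} (p₁ : Hom P A) (p₂ : Hom P B) → Set₁
  IsProduct {A} {B} {P} p₁ p₂ =
    ∀ (X : Ob) (x₁ : Hom X A) (x₂ : Hom X B) →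
      Σ (Hom X P) λ u → ((p₁ ∘ u ≈ x₁) × (p₂ ∘ u ≈ x₂)) ×
        (∀ (u′ : Hom X P) → p₁ ∘ u′ ≈ x₁ → p₂ ∘ u′ ≈ x₂ → u′ ≈ u)

  IsPullback : ∀ {A B Z P} (f : Hom A Z) (g : Hom B Z)
               (p₁ : Hom P A) (p₂ : Hom P B) → Set₁
  IsPullback {A} {B} {Z} {P} f g p₁ p₂ =
    (f ∘ p₁ ≈ g ∘ p₂) ×
    (∀ (X : Ob) (x₁ : Hom X A) (x₂ : Hom X B) → f ∘ x₁ ≈ g ∘ x₂ →
      Σ (Hom X P) λ u → ((p₁ ∘ u ≈ x₁) × (p₂ ∘ u ≈ x₂)) ×
        (∀ (u′ : Hom X P) → p₁ ∘ u′ ≈ x₁ → p₂ ∘ u′ ≈ x₂ → u′ ≈ u))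

  HasEqualizers : Set₁
  HasEqualizers = ∀ {A B : Ob} (f g : Hom A B) →
    Σ Ob λ E → Σ (Hom E A) λ e → IsEqualizer f g e

  HasBinaryProducts : Set₁
  HasBinaryProducts = ∀ (A B : Ob) →
    Σ Ob λ P → Σ (Hom P A) λ p₁ → Σ (Hom P B) λ p₂ → IsProduct p₁ p₂

  HasPullbacks : Set₁
  HasPullbacks = ∀ {A B Z : Ob} (f : Hom A Z) (g : Hom B Z) →
    Σ Ob λ P → Σ (Hom P A) λ p₁ → Σ (Hom P B) λ p₂ → IsPullback f g p₁ p₂

record Hypergraph : Set₁ where
  field
    E V : Set
    s t : E → List V

record HypMor (H H′ : Hypergraph) : Set where
  private
    module H  = Hypergraph H
    module H′ = Hypergraph H′
  field
    hE : H.E → H′.E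
    hV : H.V → H′.V
    s-comm : ∀ e → map hV (H.s e) ≡ H′.s (hE e)
    t-comm : ∀ e → map hV (H.t e) ≡ H′.t (hE e)

_≈Hyp_ : ∀ {H H′} → HypMor H H′ → HypMor H H′ → Set
f ≈Hyp g = (∀ e → HypMor.hE f e ≡ HypMor.hE g e) × (∀ v → HypMor.hV f v ≡ HypMor.hV g v)

_∘Hyp_ : ∀ {H₁ H₂ H₃} → HypMor H₂ H₃ → HypMor H₁ H₂ → HypMor H₁ H₃
_∘Hyp_ {H₁} {H₂} {H₃} g f = record
  { hE = G.hE ∘′ F.hE
  ; hV = G.hV ∘′ F.hV
  ; s-comm = λ e → trans (map-∘ (Hypergraph.s H₁ e))
                    (trans (cong (map G.hV) (F.s-comm e)) (G.s-comm (F.hE e)))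
  ; t-comm = λ e → trans (map-∘ (Hypergraph.t H₁ e))
                    (trans (cong (map G.hV) (F.t-comm e)) (G.t-comm (F.hE e)))
  }
  where module F = HypMor f
        module G = HypMor g

record Signature : Set₁ where
  field
    O  : Set
    ar : O → ℕ

-- G^Σ = (O_Σ, {*}, ar_Σ, γ₁), with {*}^⋆ ≅ ℕ via length
𝒢 : Signature → Hypergraph
𝒢 Σ′ = record
  { E = Signature.O Σ′
  ; V = ⊤
  ; s = λ o → replicate (Signature.ar Σ′ o) tt
  ; t = λ _ → tt ∷ []
  }

-- Hypergraphs with equivalence.  The set Q is a setoid (constructive
-- stand-in for a plain set, so that quotients are available);
-- q : V → Q is surjective.

record EqHypergraph : Set₁ where
  field
    E V : Set
    Q   : Setoid 0ℓ 0ℓ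
    s t : E → List V
    q   : V → Setoid.Carrier Q
    q-surj : ∀ (y : Setoid.Carrier Q) → ∃ λ (x : V) → Setoid._≈_ Q (q x) y

T : EqHypergraph → Hypergraph
T H = record { E = EqHypergraph.E H ; V = EqHypergraph.V H
             ; s = EqHypergraph.s H ; t = EqHypergraph.t H }

record EqHypMor (H H′ : EqHypergraph) : Set where
  private
    module H  = EqHypergraph H
    module H′ = EqHypergraph H′
  field
    hyp    : HypMor (T H) (T H′)
    hQ     : Setoid.Carrier H.Q → Setoid.Carrier H′.Q
    hQ-cong : ∀ {x y} → Setoid._≈_ H.Q x y → Setoid._≈_ H′.Q (hQ x) (hQ y)
    q-comm : ∀ v → Setoid._≈_ H′.Q (hQ (H.q v)) (H′.q (HypMor.hV hyp v))
  open HypMor hyp public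

_≈EqHyp_ : ∀ {H H′} → EqHypMor H H′ → EqHypMor H H′ → Set
_≈EqHyp_ {H} {H′} f g =
  (EqHypMor.hyp f ≈Hyp EqHypMor.hyp g) ×
  (∀ y → Setoid._≈_ (EqHypergraph.Q H′) (EqHypMor.hQ f y) (EqHypMor.hQ g y))

_∘EqHyp_ : ∀ {H₁ H₂ H₃} → EqHypMor H₂ H₃ → EqHypMor H₁ H₂ → EqHypMor H₁ H₃
_∘EqHyp_ {H₁} {H₂} {H₃} g f = record
  { hyp = G.hyp ∘Hyp F.hyp
  ; hQ = G.hQ ∘′ F.hQ
  ; hQ-cong = λ p → G.hQ-cong (F.hQ-cong p)
  ; q-comm = λ v → Setoid.trans (EqHypergraph.Q H₃) (G.hQ-cong (F.q-comm v)) (G.q-comm (F.hV v))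
  }
  where module F = EqHypMor f
        module G = EqHypMor g

record EqHypΣOb (Σ′ : Signature) : Set₁ where
  field
    H : EqHypergraph
    l : HypMor (T H) (𝒢 Σ′)
  open EqHypergraph H public

record EqHypΣMor {Σ′ : Signature} (A B : EqHypΣOb Σ′) : Set where
  field
    h : EqHypMor (EqHypΣOb.H A) (EqHypΣOb.H B)
    l-comm : EqHypΣOb.l A ≈Hyp (EqHypΣOb.l B ∘Hyp EqHypMor.hyp h)

EqHypΣ : Signature → Cat
EqHypΣ Σ′ = record
  { Ob  = EqHypΣOb Σ′
  ; Hom = EqHypΣMor
  ; _≈_ = λ f g → EqHypΣMor.h f ≈EqHyp EqHypΣMor.h g
  ; _∘_ = λ {A} {B} {C} g f → record
      { h = EqHypΣMor.h g ∘EqHyp EqHypΣMor.h f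
      ; l-comm = (λ e → trans (proj₁ (EqHypΣMor.l-comm f) e)
                              (proj₁ (EqHypΣMor.l-comm g) (EqHypMor.hE (EqHypΣMor.h f) e)))
               , (λ v → trans (proj₂ (EqHypΣMor.l-comm f) v)
                              (proj₂ (EqHypΣMor.l-comm g) (EqHypMor.hV (EqHypΣMor.h f) v)))
      }
  }

IsTermGraph : ∀ {Σ′} → EqHypΣOb Σ′ → Set
IsTermGraph A = Injective _≡_ _≡_ (EqHypΣOb.t A)

EqTGΣ : Signature → Cat
EqTGΣ Σ′ = record
  { Ob  = Σ (EqHypΣOb Σ′) IsTermGraph
  ; Hom = λ A B → Cat.Hom (EqHypΣ Σ′) (proj₁ A) (proj₁ B)
  ; _≈_ = Cat._≈_ (EqHypΣ Σ′)
  ; _∘_ = Cat._∘_ (EqHypΣ Σ′)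
  }

J : ∀ {Σ′} → Cat.Ob (EqTGΣ Σ′) → Cat.Ob (EqHypΣ Σ′)
J = proj₁

-- Creation of limits by the full inclusion J_Σ: every limit cone in
-- EqHyp_Σ over a diagram of the form J ∘ D (D in EqTG_Σ) lifts
-- (necessarily uniquely, J being injective on morphisms and on objects
-- up to the property IsTermGraph) to a cone in EqTG_Σ, and the lift is a
-- limit cone in EqTG_Σ.

module _ (Σ′ : Signature) where
  private
    𝓗 = EqHypΣ Σ′
    𝓣 = EqTGΣ Σ′
    open Cat 𝓗 using (Hom)

  JCreatesEqualizers : Set₁
  JCreatesEqualizers =
    ∀ {A B : Cat.Ob 𝓣} (f g : Cat.Hom 𝓣 A B) (E : Cat.Ob 𝓗) (e : Hom E (J A)) →
      IsEqualizer 𝓗 f g e →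
      Σ (IsTermGraph E) λ tg → IsEqualizer 𝓣 {A} {B} {E , tg} f g e

  JCreatesBinaryProducts : Set₁
  JCreatesBinaryProducts =
    ∀ (A B : Cat.Ob 𝓣) (P : Cat.Ob 𝓗) (p₁ : Hom P (J A)) (p₂ : Hom P (J B)) →
      IsProduct 𝓗 p₁ p₂ →
      Σ (IsTermGraph P) λ tg → IsProduct 𝓣 {A} {B} {P , tg} p₁ p₂

  JCreatesPullbacks : Set₁
  JCreatesPullbacks =
    ∀ {A B Z : Cat.Ob 𝓣} (f : Cat.Hom 𝓣 A Z) (g : Cat.Hom 𝓣 B Z)
      (P : Cat.Ob 𝓗) (p₁ : Hom P (J A)) (p₂ : Hom P (J B)) →
      IsPullback 𝓗 f g p₁ p₂ →
      Σ (IsTermGraph P) λ tg → IsPullback 𝓣 {A} {B} {Z} {P , tg} f g p₁ p₂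

{-# OPTIONS --safe #-}
-- Limits in EqHyp_Σ are tabulations of relations: the edges (vertices) of a
-- pullback, product or equalizer are the pairs of edges (vertices) that have the
-- same image, the same label, or are equal with equal images, and two such pairs
-- are equivalent when both components are. Every limit cone is jointly monic,
-- and a domain of jointly monic legs into term graphs is a term graph: two edges
-- with the same target have the same images, as targets are injective
-- downstream, so they form an edge of the kernel pair of the legs (again a
-- tabulation), whose two projections joint monicity identifies.
module Submission where

open import Level using (0ℓ)
open import Function using (id)
open import Data.Product using (Σ; _×_; _,_; proj₁; proj₂)
open import Data.Product.Relation.Binary.Pointwise.NonDependent using (_×ₛ_)
open import Data.List using (List; []; _∷_; map)
open import Data.List.Properties using (map-∘; ∷-injectiveˡ; ∷-injectiveʳ)
open import Data.List.Relation.Binary.Pointwise using (Pointwise; []; _∷_; map⁻; ≡⇒Pointwise-≡)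
open import Relation.Binary.Core using (REL)
open import Relation.Binary.Bundles using (Setoid)
open import Relation.Binary.Definitions using (Irrelevant)
open import Relation.Binary.PropositionalEquality using (_≡_; refl; sym; trans; cong; cong₂)
open import Axiom.UniquenessOfIdentityProofs.WithK using (uip)
import Relation.Binary.Construct.Intersection as Rel
import Relation.Binary.Construct.On as On
import Relation.Binary.Reasoning.Setoid as SetoidReasoning

open import Defs

diagonal : ∀ {C D : Set} (φ ψ : C → D) {a b : C} → (a ≡ b) × (φ a ≡ ψ b) → φ a ≡ ψ a
diagonal φ ψ (refl , φa≡ψa) = φa≡ψa

module _ {A B : Set} where

  Pointwise-∩ : {R S : REL A B 0ℓ} {xs : List A} {ys : List B} →
                Pointwise R xs ys → Pointwise S xs ys → Pointwise (R Rel.∩ S) xs ys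
  Pointwise-∩ []       []       = []
  Pointwise-∩ (r ∷ rs) (s ∷ ss) = (r , s) ∷ Pointwise-∩ rs ss

  ∩-irrelevant : {R S : REL A B 0ℓ} → Irrelevant R → Irrelevant S → Irrelevant (R Rel.∩ S)
  ∩-irrelevant R-irr S-irr (r , s) (r′ , s′) = cong₂ _,_ (R-irr r r′) (S-irr s s′)

  record Related (R : REL A B 0ℓ) : Set where
    constructor related
    field
      fst     : A
      snd     : B
      fst∼snd : R fst snd

  module _ {R : REL A B 0ℓ} where
    open Related

    zipped : {xs : List A} {ys : List B} → Pointwise R xs ys → List (Related R)
    zipped []       = []
    zipped (r ∷ rs) = related _ _ r ∷ zipped rs

    map-fst-zipped : {xs : List A} {ys : List B} (rs : Pointwise R xs ys) → map fst (zipped rs) ≡ xs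
    map-fst-zipped []       = refl
    map-fst-zipped (_ ∷ rs) = cong (_ ∷_) (map-fst-zipped rs)

    map-snd-zipped : {xs : List A} {ys : List B} (rs : Pointwise R xs ys) → map snd (zipped rs) ≡ ys
    map-snd-zipped []       = refl
    map-snd-zipped (_ ∷ rs) = cong (_ ∷_) (map-snd-zipped rs)

    Related-≡ : Irrelevant R → (z : Related R) {a : A} {b : B} {r : R a b} →
                fst z ≡ a → snd z ≡ b → z ≡ related a b r
    Related-≡ irr (related a b r) refl refl = cong (related a b) (irr r _)

    zipped-unique : Irrelevant R → (zs : List (Related R)) {xs : List A} {ys : List B}
                    (rs : Pointwise R xs ys) → map fst zs ≡ xs → map snd zs ≡ ys → zs ≡ zipped rs
    zipped-unique irr []       []       _ _ = refl
    zipped-unique irr (z ∷ zs) (r ∷ rs) p q =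
      cong₂ _∷_ (Related-≡ irr z (∷-injectiveˡ p) (∷-injectiveˡ q))
                (zipped-unique irr zs rs (∷-injectiveʳ p) (∷-injectiveʳ q))
    zipped-unique irr []       (_ ∷ _)  () _
    zipped-unique irr (_ ∷ _)  []       () _

module _ {H H′ C : Hypergraph} (f : HypMor H C) (g : HypMor H′ C) where
  private
    module F = HypMor f
    module G = HypMor g
  open Hypergraph

  sources-agree : ∀ {a b} → F.hE a ≡ G.hE b → Pointwise (λ v w → F.hV v ≡ G.hV w) (s H a) (s H′ b)
  sources-agree {a} {b} fa≡gb =
    map⁻ F.hV G.hV (≡⇒Pointwise-≡ (trans (F.s-comm a) (trans (cong (s C) fa≡gb) (sym (G.s-comm b)))))

  targets-agree : ∀ {a b} → F.hE a ≡ G.hE b → Pointwise (λ v w → F.hV v ≡ G.hV w) (t H a) (t H′ b)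
  targets-agree {a} {b} fa≡gb =
    map⁻ F.hV G.hV (≡⇒Pointwise-≡ (trans (F.t-comm a) (trans (cong (t C) fa≡gb) (sym (G.t-comm b)))))

module Limits (Σ′ : Signature) where
  𝓗 : Cat
  𝓗 = EqHypΣ Σ′

  open Cat 𝓗 using (Ob; Hom; _≈_; _∘_)
  open EqHypΣOb using (E; V; s; t; q; q-surj; l)
  open module Mor {A B : Ob} (f : Hom A B) = EqHypMor (EqHypΣMor.h f)
    using (hyp; hE; hV; hQ; hQ-cong; q-comm; s-comm; t-comm)
  module Q (A : Ob) = Setoid (EqHypΣOb.Q A)

  label : (A : Ob) → E A → Signature.O Σ′
  label A = HypMor.hE (l A)

  label-comm : ∀ {A B} (f : Hom A B) e → label A e ≡ label B (hE f e)
  label-comm f = proj₁ (EqHypΣMor.l-comm f)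

  preimage : (A : Ob) → Q.Carrier A → V A
  preimage A y = proj₁ (q-surj A y)

  hQ-preimage : ∀ {A B} (f : Hom A B) y → Q._≈_ B (q B (hV f (preimage A y))) (hQ f y)
  hQ-preimage {A} {B} f y = Q.trans B (Q.sym B (q-comm f _)) (hQ-cong f (proj₂ (q-surj A y)))

  ≈Hyp⇒≈ : ∀ {A B} (f g : Hom A B) → hyp f ≈Hyp hyp g → f ≈ g
  ≈Hyp⇒≈ {A} {B} f g f≈g = f≈g , λ y → begin
      hQ f y                      ≈⟨ hQ-preimage f y ⟨
      q B (hV f (preimage A y))   ≡⟨ cong (q B) (proj₂ f≈g (preimage A y)) ⟩
      q B (hV g (preimage A y))   ≈⟨ hQ-preimage g y ⟩
      hQ g y                      ∎
    where open SetoidReasoning (EqHypΣOb.Q B)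

  ≈-refl : ∀ {A B} (f : Hom A B) → f ≈ f
  ≈-refl {B = B} f = ((λ _ → refl) , (λ _ → refl)) , (λ _ → Q.refl B)

  ∘-resp-≈ˡ : ∀ {X A B} (f g : Hom A B) (u : Hom X A) → f ≈ g → f ∘ u ≈ g ∘ u
  ∘-resp-≈ˡ _ _ u ((hE≡ , hV≡) , hQ≈) = ((λ e → hE≡ (hE u e)) , (λ v → hV≡ (hV u v))) , (λ y → hQ≈ (hQ u y))

  record HypRel (A B : Ob) : Set₁ where
    field
      _∼ᴱ_          : REL (E A) (E B) 0ℓ
      _∼ⱽ_          : REL (V A) (V B) 0ℓ
      ∼ᴱ-irrelevant : Irrelevant _∼ᴱ_
      ∼ⱽ-irrelevant : Irrelevant _∼ⱽ_
      s-resp        : ∀ {a b} → a ∼ᴱ b → Pointwise _∼ⱽ_ (s A a) (s B b)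
      t-resp        : ∀ {a b} → a ∼ᴱ b → Pointwise _∼ⱽ_ (t A a) (t B b)
      label-resp    : ∀ {a b} → a ∼ᴱ b → label A a ≡ label B b

  agreeing : ∀ {A B} {C : Hypergraph} (f : HypMor (T (EqHypΣOb.H A)) C) (g : HypMor (T (EqHypΣOb.H B)) C) →
             (∀ {a b} → HypMor.hE f a ≡ HypMor.hE g b → label A a ≡ label B b) → HypRel A B
  agreeing f g label-resp = record
    { _∼ᴱ_          = λ a b → HypMor.hE f a ≡ HypMor.hE g b
    ; _∼ⱽ_          = λ v w → HypMor.hV f v ≡ HypMor.hV g w
    ; ∼ᴱ-irrelevant = uip
    ; ∼ⱽ-irrelevant = uip
    ; s-resp        = sources-agree f g
    ; t-resp        = targets-agree f g
    ; label-resp    = label-resp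
    }

  sameImage : ∀ {A B Z} → Hom A Z → Hom B Z → HypRel A B
  sameImage {Z = Z} f g = agreeing (hyp f) (hyp g) λ {a} {b} fa≡gb →
    trans (label-comm f a) (trans (cong (label Z) fa≡gb) (sym (label-comm g b)))

  -- Vertex labels live in ⊤, so the vertex relation is total.
  sameLabel : (A B : Ob) → HypRel A B
  sameLabel A B = agreeing (l A) (l B) id

  identity : (A : Ob) → HypRel A A
  identity A = record
    { _∼ᴱ_          = _≡_
    ; _∼ⱽ_          = _≡_
    ; ∼ᴱ-irrelevant = uip
    ; ∼ⱽ-irrelevant = uip
    ; s-resp        = λ a≡b → ≡⇒Pointwise-≡ (cong (s A) a≡b)
    ; t-resp        = λ a≡b → ≡⇒Pointwise-≡ (cong (t A) a≡b)
    ; label-resp    = cong (label A)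
    }

  _∩_ : ∀ {A B} → HypRel A B → HypRel A B → HypRel A B
  R ∩ S = record
    { _∼ᴱ_          = R._∼ᴱ_ Rel.∩ S._∼ᴱ_
    ; _∼ⱽ_          = R._∼ⱽ_ Rel.∩ S._∼ⱽ_
    ; ∼ᴱ-irrelevant = ∩-irrelevant {R = R._∼ᴱ_} {S._∼ᴱ_} R.∼ᴱ-irrelevant S.∼ᴱ-irrelevant
    ; ∼ⱽ-irrelevant = ∩-irrelevant {R = R._∼ⱽ_} {S._∼ⱽ_} R.∼ⱽ-irrelevant S.∼ⱽ-irrelevant
    ; s-resp        = λ (r , s) → Pointwise-∩ (R.s-resp r) (S.s-resp s)
    ; t-resp        = λ (r , s) → Pointwise-∩ (R.t-resp r) (S.t-resp s)
    ; label-resp    = λ (r , _) → R.label-resp r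
    }
    where module R = HypRel R
          module S = HypRel S

  module Tabulation {A B : Ob} (R : HypRel A B) where
    open HypRel R
    open Related

    graph : EqHypergraph
    graph = record
      { E      = Related _∼ᴱ_
      ; V      = Related _∼ⱽ_
      ; Q      = On.setoid (EqHypΣOb.Q A ×ₛ EqHypΣOb.Q B) (λ v → q A (fst v) , q B (snd v))
      ; s      = λ e → zipped (s-resp (fst∼snd e))
      ; t      = λ e → zipped (t-resp (fst∼snd e))
      ; q      = id
      ; q-surj = λ v → v , (Q.refl A , Q.refl B)
      }

    fstᴴ : HypMor (T graph) (T (EqHypΣOb.H A))
    fstᴴ = record
      { hE = fst ; hV = fst
      ; s-comm = λ e → map-fst-zipped (s-resp (fst∼snd e))
      ; t-comm = λ e → map-fst-zipped (t-resp (fst∼snd e))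
      }

    sndᴴ : HypMor (T graph) (T (EqHypΣOb.H B))
    sndᴴ = record
      { hE = snd ; hV = snd
      ; s-comm = λ e → map-snd-zipped (s-resp (fst∼snd e))
      ; t-comm = λ e → map-snd-zipped (t-resp (fst∼snd e))
      }

    Tab : Ob
    Tab = record { H = graph ; l = l A ∘Hyp fstᴴ }

    π₁ : Hom Tab A
    π₁ = record
      { h = record { hyp = fstᴴ ; hQ = λ v → q A (fst v) ; hQ-cong = proj₁ ; q-comm = λ _ → Q.refl A }
      ; l-comm = (λ _ → refl) , (λ _ → refl)
      }

    π₂ : Hom Tab B
    π₂ = record
      { h = record { hyp = sndᴴ ; hQ = λ v → q B (snd v) ; hQ-cong = proj₂ ; q-comm = λ _ → Q.refl B }
      ; l-comm = (λ e → label-resp (fst∼snd e)) , (λ _ → refl)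
      }

    module _ {X : Ob} (x₁ : Hom X A) (x₂ : Hom X B)
             (rᴱ : ∀ e → hE x₁ e ∼ᴱ hE x₂ e) (rⱽ : ∀ v → hV x₁ v ∼ⱽ hV x₂ v) where

      pairⱽ : V X → Related _∼ⱽ_
      pairⱽ v = related (hV x₁ v) (hV x₂ v) (rⱽ v)

      pairᴴ : HypMor (T (EqHypΣOb.H X)) (T graph)
      pairᴴ = record
        { hE = λ e → related (hE x₁ e) (hE x₂ e) (rᴱ e)
        ; hV = pairⱽ
        ; s-comm = λ e → zipped-unique ∼ⱽ-irrelevant (map pairⱽ (s X e)) (s-resp (rᴱ e))
                           (trans (sym (map-∘ (s X e))) (s-comm x₁ e))
                           (trans (sym (map-∘ (s X e))) (s-comm x₂ e))
        ; t-comm = λ e → zipped-unique ∼ⱽ-irrelevant (map pairⱽ (t X e)) (t-resp (rᴱ e))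
                           (trans (sym (map-∘ (t X e))) (t-comm x₁ e))
                           (trans (sym (map-∘ (t X e))) (t-comm x₂ e))
        }

      factor : Hom X Tab
      factor = record
        { h = record
          { hyp     = pairᴴ
          ; hQ      = λ y → pairⱽ (preimage X y)
          ; hQ-cong = λ {y} {y′} y≈y′ →
              Q.trans A (hQ-preimage x₁ y) (Q.trans A (hQ-cong x₁ y≈y′) (Q.sym A (hQ-preimage x₁ y′))) ,
              Q.trans B (hQ-preimage x₂ y) (Q.trans B (hQ-cong x₂ y≈y′) (Q.sym B (hQ-preimage x₂ y′)))
          ; q-comm  = λ v → Q.trans A (hQ-preimage x₁ (q X v)) (q-comm x₁ v) ,
                            Q.trans B (hQ-preimage x₂ (q X v)) (q-comm x₂ v)
          }
        ; l-comm = label-comm x₁ , (λ _ → refl)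
        }

      π₁∘factor : π₁ ∘ factor ≈ x₁
      π₁∘factor = ((λ _ → refl) , (λ _ → refl)) , hQ-preimage x₁

      π₂∘factor : π₂ ∘ factor ≈ x₂
      π₂∘factor = ((λ _ → refl) , (λ _ → refl)) , hQ-preimage x₂

      factor-unique : (u : Hom X Tab) → hyp (π₁ ∘ u) ≈Hyp hyp x₁ → hyp (π₂ ∘ u) ≈Hyp hyp x₂ → u ≈ factor
      factor-unique u (ᴱ₁ , ⱽ₁) (ᴱ₂ , ⱽ₂) = ≈Hyp⇒≈ u factor
        ((λ e → Related-≡ ∼ᴱ-irrelevant (hE u e) (ᴱ₁ e) (ᴱ₂ e)) ,
         (λ v → Related-≡ ∼ⱽ-irrelevant (hV u v) (ⱽ₁ v) (ⱽ₂ v)))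

      universal : Σ (Hom X Tab) λ u → ((π₁ ∘ u ≈ x₁) × (π₂ ∘ u ≈ x₂)) ×
                    (∀ (u′ : Hom X Tab) → π₁ ∘ u′ ≈ x₁ → π₂ ∘ u′ ≈ x₂ → u′ ≈ u)
      universal = factor , (π₁∘factor , π₂∘factor) , λ u′ c₁ c₂ → factor-unique u′ (proj₁ c₁) (proj₁ c₂)

    ∘π₁≈∘π₂ : ∀ {Z} (f : Hom A Z) (g : Hom B Z) →
              (∀ {a b} → a ∼ᴱ b → hE f a ≡ hE g b) → (∀ {v w} → v ∼ⱽ w → hV f v ≡ hV g w) →
              f ∘ π₁ ≈ g ∘ π₂
    ∘π₁≈∘π₂ f g ᴱ ⱽ = ≈Hyp⇒≈ (f ∘ π₁) (g ∘ π₂) ((λ e → ᴱ (fst∼snd e)) , (λ v → ⱽ (fst∼snd v)))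

  EqHyp-equalizers : HasEqualizers 𝓗
  EqHyp-equalizers {A} f g = Tab , π₁ , commutes , factorisation
    where
      open Tabulation (identity A ∩ sameImage f g)
      open Related

      commutes : f ∘ π₁ ≈ g ∘ π₁
      commutes = ≈Hyp⇒≈ (f ∘ π₁) (g ∘ π₁)
        ((λ e → diagonal (hE f) (hE g) (fst∼snd e)) , (λ v → diagonal (hV f) (hV g) (fst∼snd v)))

      factorisation : ∀ X (x : Hom X A) → f ∘ x ≈ g ∘ x →
                      Σ (Hom X Tab) λ u → (π₁ ∘ u ≈ x) × (∀ (u′ : Hom X Tab) → π₁ ∘ u′ ≈ x → u′ ≈ u)
      factorisation X x ((fx≡gxᴱ , fx≡gxⱽ) , _) =
          factor x x rᴱ rⱽ , π₁∘factor x x rᴱ rⱽ , λ u ((π₁u≡xᴱ , π₁u≡xⱽ) , _) →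
            factor-unique x x rᴱ rⱽ u (π₁u≡xᴱ , π₁u≡xⱽ)
              ((λ e → trans (sym (proj₁ (fst∼snd (hE u e)))) (π₁u≡xᴱ e)) ,
               (λ v → trans (sym (proj₁ (fst∼snd (hV u v)))) (π₁u≡xⱽ v)))
        where
          rᴱ : ∀ e → hE x e ≡ hE x e × hE f (hE x e) ≡ hE g (hE x e)
          rᴱ e = refl , fx≡gxᴱ e
          rⱽ : ∀ v → hV x v ≡ hV x v × hV f (hV x v) ≡ hV g (hV x v)
          rⱽ v = refl , fx≡gxⱽ v

  EqHyp-products : HasBinaryProducts 𝓗
  EqHyp-products A B = Tab , π₁ , π₂ , λ X x₁ x₂ →
      universal x₁ x₂ (λ e → trans (sym (label-comm x₁ e)) (label-comm x₂ e)) (λ _ → refl)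
    where open Tabulation (sameLabel A B)

  EqHyp-pullbacks : HasPullbacks 𝓗
  EqHyp-pullbacks f g = Tab , π₁ , π₂ , ∘π₁≈∘π₂ f g id id , λ X x₁ x₂ ((ᴱ , ⱽ) , _) → universal x₁ x₂ ᴱ ⱽ
    where open Tabulation (sameImage f g)

  JointlyMonic : ∀ {P A B} → Hom P A → Hom P B → Set₁
  JointlyMonic {P} p₁ p₂ = ∀ {X} (u u′ : Hom X P) → p₁ ∘ u ≈ p₁ ∘ u′ → p₂ ∘ u ≈ p₂ ∘ u′ → u ≈ u′

  uniqueFactors⇒jointlyMonic : ∀ {P A B} (p₁ : Hom P A) (p₂ : Hom P B) →
    (∀ {X} (u : Hom X P) → Σ (Hom X P) λ m → ∀ u′ → p₁ ∘ u′ ≈ p₁ ∘ u → p₂ ∘ u′ ≈ p₂ ∘ u → u′ ≈ m) →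
    JointlyMonic p₁ p₂
  uniqueFactors⇒jointlyMonic p₁ p₂ factors u u′ c₁ c₂ =
    let (m , unique) = factors u′
        ((u≈mᴱ , u≈mⱽ) , _) = unique u c₁ c₂
        ((u′≈mᴱ , u′≈mⱽ) , _) = unique u′ (≈-refl (p₁ ∘ u′)) (≈-refl (p₂ ∘ u′))
    in ≈Hyp⇒≈ u u′ ((λ e → trans (u≈mᴱ e) (sym (u′≈mᴱ e))) , (λ v → trans (u≈mⱽ v) (sym (u′≈mⱽ v))))

  isEqualizer⇒monic : ∀ {A B E} {f g : Hom A B} {e : Hom E A} → IsEqualizer 𝓗 f g e → JointlyMonic e e
  isEqualizer⇒monic {f = f} {g} {e} (commutes , universal) = uniqueFactors⇒jointlyMonic e e λ u →
    let (m , _ , unique) = universal _ (e ∘ u) (∘-resp-≈ˡ (f ∘ e) (g ∘ e) u commutes)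
    in m , λ u′ c _ → unique u′ c

  isProduct⇒jointlyMonic : ∀ {A B P} {p₁ : Hom P A} {p₂ : Hom P B} → IsProduct 𝓗 p₁ p₂ → JointlyMonic p₁ p₂
  isProduct⇒jointlyMonic {p₁ = p₁} {p₂} universal = uniqueFactors⇒jointlyMonic p₁ p₂ λ u →
    let (m , _ , unique) = universal _ (p₁ ∘ u) (p₂ ∘ u) in m , unique

  isPullback⇒jointlyMonic : ∀ {A B Z P} {f : Hom A Z} {g : Hom B Z} {p₁ : Hom P A} {p₂ : Hom P B} →
                            IsPullback 𝓗 f g p₁ p₂ → JointlyMonic p₁ p₂
  isPullback⇒jointlyMonic {f = f} {g} {p₁} {p₂} (commutes , universal) = uniqueFactors⇒jointlyMonic p₁ p₂ λ u →
    let (m , _ , unique) = universal _ (p₁ ∘ u) (p₂ ∘ u) (∘-resp-≈ˡ (f ∘ p₁) (g ∘ p₂) u commutes)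
    in m , unique

  jointlyMonic⇒jointlyInjective : ∀ {P A B} (p₁ : Hom P A) (p₂ : Hom P B) → JointlyMonic p₁ p₂ →
                                  ∀ {e e′} → hE p₁ e ≡ hE p₁ e′ → hE p₂ e ≡ hE p₂ e′ → e ≡ e′
  jointlyMonic⇒jointlyInjective p₁ p₂ monic r₁ r₂ =
    proj₁ (proj₁ (monic π₁ π₂ (∘π₁≈∘π₂ p₁ p₁ proj₁ proj₁) (∘π₁≈∘π₂ p₂ p₂ proj₂ proj₂))) (related _ _ (r₁ , r₂))
    where open Tabulation (sameImage p₁ p₁ ∩ sameImage p₂ p₂)

  sameTarget⇒sameImage : ∀ {P C} → IsTermGraph C → (p : Hom P C) →
                         ∀ {e e′} → t P e ≡ t P e′ → hE p e ≡ hE p e′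
  sameTarget⇒sameImage C-tg p {e} {e′} te≡te′ =
    C-tg (trans (sym (t-comm p e)) (trans (cong (map (hV p)) te≡te′) (t-comm p e′)))

  jointlyMonic⇒termGraph : ∀ {P A B} → IsTermGraph A → IsTermGraph B →
                           (p₁ : Hom P A) (p₂ : Hom P B) → JointlyMonic p₁ p₂ → IsTermGraph P
  jointlyMonic⇒termGraph A-tg B-tg p₁ p₂ monic te≡te′ =
    jointlyMonic⇒jointlyInjective p₁ p₂ monic
      (sameTarget⇒sameImage A-tg p₁ te≡te′) (sameTarget⇒sameImage B-tg p₂ te≡te′)

  𝓣 : Cat
  𝓣 = EqTGΣ Σ′

  J-creates-equalizers : JCreatesEqualizers Σ′
  J-creates-equalizers {A , A-tg} f g E e equalizer@(commutes , universal) =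
    jointlyMonic⇒termGraph A-tg A-tg e e (isEqualizer⇒monic {f = f} {g} {e} equalizer) ,
    commutes , λ X → universal (proj₁ X)

  J-creates-products : JCreatesBinaryProducts Σ′
  J-creates-products (A , A-tg) (B , B-tg) P p₁ p₂ product =
    jointlyMonic⇒termGraph A-tg B-tg p₁ p₂ (isProduct⇒jointlyMonic {p₁ = p₁} {p₂} product) ,
    λ X → product (proj₁ X)

  J-creates-pullbacks : JCreatesPullbacks Σ′
  J-creates-pullbacks {A , A-tg} {B , B-tg} f g P p₁ p₂ pullback@(commutes , universal) =
    jointlyMonic⇒termGraph A-tg B-tg p₁ p₂ (isPullback⇒jointlyMonic {f = f} {g} {p₁} {p₂} pullback) ,
    commutes , λ X → universal (proj₁ X)

  EqTG-equalizers : HasEqualizers 𝓣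
  EqTG-equalizers {A} {B} f g =
    let (E , e , equalizer) = EqHyp-equalizers f g
        (E-tg , equalizerᵀ) = J-creates-equalizers {A} {B} f g E e equalizer
    in (E , E-tg) , e , equalizerᵀ

  EqTG-products : HasBinaryProducts 𝓣
  EqTG-products A B =
    let (P , p₁ , p₂ , product) = EqHyp-products (J A) (J B)
        (P-tg , productᵀ) = J-creates-products A B P p₁ p₂ product
    in (P , P-tg) , p₁ , p₂ , productᵀ

  EqTG-pullbacks : HasPullbacks 𝓣
  EqTG-pullbacks {A} {B} {Z} f g =
    let (P , p₁ , p₂ , pullback) = EqHyp-pullbacks f g
        (P-tg , pullbackᵀ) = J-creates-pullbacks {A} {B} {Z} f g P p₁ p₂ pullback
    in (P , P-tg) , p₁ , p₂ , pullbackᵀ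

proposition4p23 : (Σ′ : Signature) →
    (HasEqualizers (EqTGΣ Σ′) × HasBinaryProducts (EqTGΣ Σ′) × HasPullbacks (EqTGΣ Σ′)) ×
    (JCreatesEqualizers Σ′ × JCreatesBinaryProducts Σ′ × JCreatesPullbacks Σ′)
proposition4p23 Σ′ =
  ( (λ {A} {B} → EqTG-equalizers {A} {B})
  , EqTG-products
  , (λ {A} {B} {Z} → EqTG-pullbacks {A} {B} {Z}) )
  ,
  ( (λ {A} {B} → J-creates-equalizers {A} {B})
  , J-creates-products
  , (λ {A} {B} {Z} → J-creates-pullbacks {A} {B} {Z}) )
  where open Limits Σ′
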